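{- Let $n,h,M$ be positive integers and let $I$ be an odd positive integer, $\ell\in\mathbb{N}$. Then \[ \sum_{\substack{i_{1}+\cdots+i_{2M}=I \\ 0\leq i_{1},\ldots,i_{2M}\leq n}}\tilde{A}_{i_{1},\ldots,i_{2M}}^{(\ell,h)}\prod_{j=1}^{2M}C_{i_{j}}^{h-1}\equiv0\pmod 2. \]
   Context: $C_i=\frac{1}{i+1}\binom{2i}{i}$ is the Catalan number. For $m,h\in\mathbb{Z}^+$ and $i_1,\dots,i_m\in\mathbb{N}$, the integers $\tilde{A}_{i_{1},\ldots,i_{m}}^{(\ell,h)}$ ($0\le\ell\le h(i_1+\cdots+i_m)$) are the unique coefficients, independent of $k$, such that as polynomials in $k$ \[ \prod_{j=1}^{m}\binom{k+i_j}{2i_j}^{h}\frac{1}{i_j+1}\binom{2i_j}{i_j}=\sum_{\ell=0}^{h(i_1+\cdots+i_m)}\tilde{A}_{i_{1},\ldots,i_{m}}^{(\ell,h)}\frac{1}{\ell+1}\binom{k+\ell}{2\ell}\binom{2\ell}{\ell}, \] where $\binom{k+\ell}{2\ell}=\frac{(k+\ell)(k+\ell-1)\cdots(k-\ell+1)}{(2\ell)!}$; these coefficients are integers. -}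

module Defs where

open import Data.Nat using (ℕ; zero; suc; _+_; _*_; _∸_; _^_; _<_; _/_)
open import Data.Nat.Properties using (_≟_)
open import Data.Nat.Combinatorics using (_C_)
open import Data.Integer using (ℤ; +_) renaming (_+_ to _+ℤ_; _*_ to _*ℤ_)
open import Data.List using (List; []; _∷_; map; concatMap; upTo; foldr; filter)
open import Data.Vec using (Vec; []; _∷_; toList) renaming (sum to vsum; map to vmap)
open import Data.Product using (_×_)
open import Relation.Binary.PropositionalEquality using (_≡_)

-- Catalan number C_i = binom(2i,i)/(i+1)  (exact division)
catalan : ℕ → ℕ
catalan i = ((2 * i) C i) / suc i

-- binom(k+ℓ, 2ℓ) evaluated at a natural number k
-- (for k ∈ ℕ the falling-factorial definition agrees with the usual binomial)
binomK : ℕ → ℕ → ℕ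
binomK k ℓ = (k + ℓ) C (2 * ℓ)

sumℤ : List ℤ → ℤ
sumℤ = foldr _+ℤ_ (+ 0)

prodℤ : List ℤ → ℤ
prodℤ = foldr _*ℤ_ (+ 1)

-- A is the coefficient family Ã^{(ℓ,h)}_{i_1..i_m} (indexed by the tuple v and ℓ):
-- the polynomial identity in k (checked at all k ∈ ℕ, which determines a
-- polynomial identity), and Ã = 0 outside the range 0 ≤ ℓ ≤ h(i_1+…+i_m).
IsAtilde : (h m : ℕ) → (Vec ℕ m → ℕ → ℤ) → Set
IsAtilde h m A =
  ((v : Vec ℕ m) (k : ℕ) →
     prodℤ (toList (vmap (λ i → + ((binomK k i ^ h) * catalan i)) v))
     ≡ sumℤ (map (λ ℓ → A v ℓ *ℤ + (catalan ℓ * binomK k ℓ)) (upTo (suc (h * vsum v)))))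
  × ((v : Vec ℕ m) (ℓ : ℕ) → h * vsum v < ℓ → A v ℓ ≡ + 0)

tuples : (m n : ℕ) → List (Vec ℕ m)
tuples zero n = [] ∷ []
tuples (suc m) n = concatMap (λ i → map (i ∷_) (tuples m n)) (upTo (suc n))

lemmaSum : (n h M I ℓ : ℕ) → (Vec ℕ (2 * M) → ℕ → ℤ) → ℤ
lemmaSum n h M I ℓ A =
  sumℤ (map (λ v → A v ℓ *ℤ prodℤ (toList (vmap (λ i → + (catalan i ^ (h ∸ 1))) v)))
            (filter (λ v → vsum v ≟ I) (tuples (2 * M) n)))

-- Since ∏ binom(k+i_j, 2 i_j)^h C_{i_j} is symmetric in the i_j, and the basis
-- C_ℓ binom(k+ℓ, 2ℓ) is triangular (it vanishes at k < ℓ and is nonzero at k = ℓ),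
-- the coefficients Ã are symmetric in the indices, and so is every summand.
-- Group the 2M indices into M pairs. Summing over the first pair, the terms
-- (i, j) and (j, i) with i ≠ j cancel modulo 2, leaving the diagonal i = j; by
-- induction on M the sum is congruent to the sum over tuples whose pairs are all
-- diagonal. Such tuples have even total, so none of them sums to the odd I.

module Submission where

open import Defs
open import Data.Nat using (ℕ; _*_; _≤_; _+_)
open import Data.Integer using (ℤ; +_)
open import Data.Integer.Divisibility using (_∣_)
open import Data.Vec using (Vec)
open import Data.Product using (∃)
open import Relation.Binary.PropositionalEquality using (_≡_)

open import Data.Nat using (zero; suc; _<_; _∸_; _^_; s≤s; z≤n)
open import Data.Nat.Properties as ℕ using (_≟_; _<?_; <-cmp; ≮⇒≥; +-suc; m<m+n; module ≤-Reasoning)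
open import Data.Nat.Combinatorics using (_C_; nCn≡1; k>n⇒nCk≡0; nCk+nC[k+1]≡[n+1]C[k+1])
open import Data.Nat.DivMod using (m≥n⇒m/n>0)
open import Data.Nat.Induction using (<-rec)
open import Data.Integer using (0ℤ) renaming (_+_ to _+ℤ_; _*_ to _*ℤ_; _-_ to _-ℤ_)
import Data.Integer.Properties as ℤ
open import Data.Integer.Divisibility.Signed as Signed using (divides; ∣m∣n⇒∣m+n; ∣⇒∣ᵤ)
open import Data.Integer.Tactic.RingSolver using (solve-∀)
open import Data.List using (List; []; _∷_; map; concatMap; upTo; applyUpTo; filter; _++_)
open import Data.List.Properties using (map-∘; map-cong; map-upTo)
open import Data.Vec using ([]; _∷_; toList) renaming (sum to vsum; map to vmap)
open import Data.Product using (_,_)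
open import Data.Sum using ([_,_]′)
open import Data.Bool using (true; false; if_then_else_)
open import Data.Empty using (⊥-elim)
open import Function using (_∘_; id)
open import Relation.Nullary using (¬_; does; yes; no)
open import Relation.Nullary.Decidable using (dec-false)
open import Relation.Unary using (Decidable)
open import Relation.Binary.Definitions using (tri<; tri≈; tri>)
open import Relation.Binary.PropositionalEquality using (_≢_; refl; sym; trans; cong; cong₂; subst; module ≡-Reasoning)
open import Algebra.Properties.CommutativeSemigroup ℕ.+-commutativeSemigroup
  using () renaming (x∙yz≈y∙xz to +-exchange)
open import Algebra.Properties.CommutativeSemigroup ℤ.*-commutativeSemigroup
  using () renaming (x∙yz≈y∙xz to *-exchange)
open import Algebra.Properties.CommutativeSemigroup ℤ.+-commutativeSemigroup
  using () renaming (interchange to +-interchange)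

private
  variable
    A B : Set
    N : ℕ

∑ : List A → (A → ℤ) → ℤ
∑ xs f = sumℤ (map f xs)

∑-cong : {f g : A → ℤ} → (∀ x → f x ≡ g x) → (xs : List A) → ∑ xs f ≡ ∑ xs g
∑-cong f≗g xs = cong sumℤ (map-cong f≗g xs)

∑-map : (g : A → B) (xs : List A) (f : B → ℤ) → ∑ (map g xs) f ≡ ∑ xs (f ∘ g)
∑-map g xs f = cong sumℤ (sym (map-∘ xs))

∑-++ : (xs ys : List A) (f : A → ℤ) → ∑ (xs ++ ys) f ≡ ∑ xs f +ℤ ∑ ys f
∑-++ []       ys f = sym (ℤ.+-identityˡ _)
∑-++ (x ∷ xs) ys f = trans (cong (f x +ℤ_) (∑-++ xs ys f)) (sym (ℤ.+-assoc (f x) _ _))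

∑-concatMap : (g : A → List B) (xs : List A) (f : B → ℤ) →
  ∑ (concatMap g xs) f ≡ ∑ xs (λ x → ∑ (g x) f)
∑-concatMap g []       f = refl
∑-concatMap g (x ∷ xs) f = trans (∑-++ (g x) _ f) (cong (∑ (g x) f +ℤ_) (∑-concatMap g xs f))

∑-distrib-+ : (xs : List A) (f g : A → ℤ) → ∑ xs (λ x → f x +ℤ g x) ≡ ∑ xs f +ℤ ∑ xs g
∑-distrib-+ []       f g = refl
∑-distrib-+ (x ∷ xs) f g =
  trans (cong (f x +ℤ g x +ℤ_) (∑-distrib-+ xs f g)) (+-interchange (f x) (g x) (∑ xs f) (∑ xs g))

∑-distrib-− : (xs : List A) (f g : A → ℤ) → ∑ xs (λ x → f x -ℤ g x) ≡ ∑ xs f -ℤ ∑ xs g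
∑-distrib-− []       f g = refl
∑-distrib-− (x ∷ xs) f g =
  trans (cong (f x -ℤ g x +ℤ_) (∑-distrib-− xs f g)) (−-interchange (f x) (g x) (∑ xs f) (∑ xs g))
  where
    −-interchange : ∀ a b c d → (a -ℤ b) +ℤ (c -ℤ d) ≡ (a +ℤ c) -ℤ (b +ℤ d)
    −-interchange = solve-∀

∑-filter : {P : A → Set} (P? : Decidable P) (xs : List A) (f : A → ℤ) →
  ∑ (filter P? xs) f ≡ ∑ xs (λ x → if does (P? x) then f x else 0ℤ)
∑-filter P? []       f = refl
∑-filter P? (x ∷ xs) f with does (P? x)
... | true  = cong (f x +ℤ_) (∑-filter P? xs f)
... | false = trans (∑-filter P? xs f) (sym (ℤ.+-identityˡ _))

sumℤ-applyUpTo-vanishing : (φ : ℕ → ℤ) (n : ℕ) → (∀ i → i < n → φ i ≡ 0ℤ) →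
  sumℤ (applyUpTo φ n) ≡ 0ℤ
sumℤ-applyUpTo-vanishing φ zero    _  = refl
sumℤ-applyUpTo-vanishing φ (suc n) φ≡0 =
  cong₂ _+ℤ_ (φ≡0 0 (s≤s z≤n)) (sumℤ-applyUpTo-vanishing (φ ∘ suc) n (λ i i<n → φ≡0 (suc i) (s≤s i<n)))

sumℤ-applyUpTo-single : (φ : ℕ → ℤ) {n ℓ : ℕ} → ℓ < n → (∀ i → i < n → i ≢ ℓ → φ i ≡ 0ℤ) →
  sumℤ (applyUpTo φ n) ≡ φ ℓ
sumℤ-applyUpTo-single φ {suc n} {zero} _ φ≡0 =
  trans (cong (φ 0 +ℤ_) (sumℤ-applyUpTo-vanishing (φ ∘ suc) n (λ i i<n → φ≡0 (suc i) (s≤s i<n) λ ())))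
        (ℤ.+-identityʳ (φ 0))
sumℤ-applyUpTo-single φ {suc n} {suc ℓ} (s≤s ℓ<n) φ≡0 =
  trans (cong₂ _+ℤ_ (φ≡0 0 (s≤s z≤n) λ ())
    (sumℤ-applyUpTo-single (φ ∘ suc) ℓ<n (λ i i<n i≢ℓ → φ≡0 (suc i) (s≤s i<n) (i≢ℓ ∘ ℕ.suc-injective))))
    (ℤ.+-identityˡ (φ (suc ℓ)))

2∣a+a : ∀ a → + 2 Signed.∣ a +ℤ a
2∣a+a a = divides a (a+a≡a*2 a)
  where
    a+a≡a*2 : ∀ a → a +ℤ a ≡ a *ℤ + 2
    a+a≡a*2 = solve-∀

symmetric-double-sum-even : (xs : List A) (g : A → A → ℤ) →
  (∀ x y → g x y ≡ g y x) → (∀ x → + 2 Signed.∣ g x x) →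
  + 2 Signed.∣ ∑ xs (λ x → ∑ xs (g x))
symmetric-double-sum-even []       g g-sym 2∣diag = divides 0ℤ refl
symmetric-double-sum-even (x ∷ xs) g g-sym 2∣diag =
  subst (+ 2 Signed.∣_) (sym regroup)
    (∣m∣n⇒∣m+n (∣m∣n⇒∣m+n (2∣diag x) (symmetric-double-sum-even xs g g-sym 2∣diag)) (2∣a+a row))
  where
    open ≡-Reasoning
    row = ∑ xs (g x)
    rest = ∑ xs (λ y → ∑ xs (g y))
    swap-middle : ∀ a r d → (a +ℤ r) +ℤ (r +ℤ d) ≡ (a +ℤ d) +ℤ (r +ℤ r)
    swap-middle = solve-∀
    regroup : ∑ (x ∷ xs) (λ y → ∑ (x ∷ xs) (g y)) ≡ (g x x +ℤ rest) +ℤ (row +ℤ row)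
    regroup = begin
      (g x x +ℤ row) +ℤ ∑ xs (λ y → g y x +ℤ ∑ xs (g y))
        ≡⟨ cong (g x x +ℤ row +ℤ_) (∑-distrib-+ xs (λ y → g y x) (λ y → ∑ xs (g y))) ⟩
      (g x x +ℤ row) +ℤ (∑ xs (λ y → g y x) +ℤ rest)
        ≡⟨ cong (λ column → g x x +ℤ row +ℤ (column +ℤ rest)) (∑-cong (λ y → g-sym y x) xs) ⟩
      (g x x +ℤ row) +ℤ (row +ℤ rest)
        ≡⟨ swap-middle (g x x) row rest ⟩
      (g x x +ℤ rest) +ℤ (row +ℤ row) ∎

data Even : ℕ → Set where
  even-zero    : Even 0
  even-suc-suc : Even N → Even (suc (suc N))

even-2* : ∀ m → Even (2 * m)
even-2* zero    = even-zero
even-2* (suc m) = subst (Even ∘ suc) (sym (+-suc m (m + 0))) (even-suc-suc (even-2* m))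

even-i+i+ : ∀ i {s} → Even s → Even (i + (i + s))
even-i+i+ zero    e = e
even-i+i+ (suc i) {s} e = subst (Even ∘ suc) (sym (+-suc i (i + s))) (even-suc-suc (even-i+i+ i e))

even⇒¬even-suc : Even N → ¬ Even (suc N)
even⇒¬even-suc even-zero        ()
even⇒¬even-suc (even-suc-suc e) (even-suc-suc e′) = even⇒¬even-suc e e′

data PairSwap {A : Set} : {n : ℕ} → Vec A n → Vec A n → Set where
  swap-head : ∀ {n} x y (w : Vec A n) → PairSwap (x ∷ y ∷ w) (y ∷ x ∷ w)
  swap-tail : ∀ {n} x y {w w′ : Vec A n} → PairSwap w w′ → PairSwap (x ∷ y ∷ w) (x ∷ y ∷ w′)

PairSwap-vsum : {u v : Vec ℕ N} → PairSwap u v → vsum u ≡ vsum v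
PairSwap-vsum (swap-head x y w) = +-exchange x y (vsum w)
PairSwap-vsum (swap-tail x y s) = cong (λ t → x + (y + t)) (PairSwap-vsum s)

PairSwap-prodℤ : (c : A → ℤ) {u v : Vec A N} → PairSwap u v →
  prodℤ (toList (vmap c u)) ≡ prodℤ (toList (vmap c v))
PairSwap-prodℤ c (swap-head x y w) = *-exchange (c x) (c y) _
PairSwap-prodℤ c (swap-tail x y s) = cong (λ t → c x *ℤ (c y *ℤ t)) (PairSwap-prodℤ c s)

∑-tuples-suc : ∀ m n (F : Vec ℕ (suc m) → ℤ) →
  ∑ (tuples (suc m) n) F ≡ ∑ (upTo (suc n)) (λ i → ∑ (tuples m n) (F ∘ (i ∷_)))
∑-tuples-suc m n F =
  trans (∑-concatMap (λ i → map (i ∷_) (tuples m n)) (upTo (suc n)) F) (∑-cong (λ i → ∑-map (i ∷_) (tuples m n) F) (upTo (suc n)))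

PairSwap-invariant-sum-even : ∀ n → Even N → (F : Vec ℕ N → ℤ) →
  (∀ {u v} → PairSwap u v → F u ≡ F v) → (∀ v → Even (vsum v) → F v ≡ 0ℤ) →
  + 2 Signed.∣ ∑ (tuples N n) F
PairSwap-invariant-sum-even n even-zero F _ F≡0 =
  subst (λ z → + 2 Signed.∣ z +ℤ 0ℤ) (sym (F≡0 [] even-zero)) (divides 0ℤ refl)
PairSwap-invariant-sum-even n (even-suc-suc {N} e) F F-inv F≡0 =
  subst (+ 2 Signed.∣_) (sym as-double-sum) (symmetric-double-sum-even (upTo (suc n)) g g-sym 2∣diag)
  where
    g : ℕ → ℕ → ℤ
    g i j = ∑ (tuples N n) (λ w → F (i ∷ j ∷ w))
    as-double-sum : ∑ (tuples (suc (suc N)) n) F ≡ ∑ (upTo (suc n)) (λ i → ∑ (upTo (suc n)) (g i))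
    as-double-sum = trans (∑-tuples-suc (suc N) n F)
      (∑-cong (λ i → ∑-tuples-suc N n (F ∘ (i ∷_))) (upTo (suc n)))
    g-sym : ∀ i j → g i j ≡ g j i
    g-sym i j = ∑-cong (λ w → F-inv (swap-head i j w)) (tuples N n)
    2∣diag : ∀ i → + 2 Signed.∣ g i i
    2∣diag i = PairSwap-invariant-sum-even n e (λ w → F (i ∷ i ∷ w))
      (F-inv ∘ swap-tail i i) (λ w even → F≡0 (i ∷ i ∷ w) (even-i+i+ i even))

k≤n⇒nCk>0 : ∀ {n k} → k ≤ n → 0 < n C k
k≤n⇒nCk>0 {n}     {zero}  _         = s≤s z≤n
k≤n⇒nCk>0 {suc n} {suc k} (s≤s k≤n) =
  subst (0 <_) (nCk+nC[k+1]≡[n+1]C[k+1] n k) (ℕ.≤-trans (k≤n⇒nCk>0 k≤n) (ℕ.m≤m+n _ _))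

k<n⇒k<nCk : ∀ {n k} → k < n → k < n C k
k<n⇒k<nCk {n}     {zero}  k<n       = k≤n⇒nCk>0 {n} z≤n
k<n⇒k<nCk {suc n} {suc k} (s≤s k<n) = begin-strict
  suc k                   ≤⟨ k<n⇒k<nCk k<n ⟩
  n C k                   <⟨ m<m+n (n C k) (k≤n⇒nCk>0 k<n) ⟩
  n C k + n C suc k       ≡⟨ nCk+nC[k+1]≡[n+1]C[k+1] n k ⟩
  suc n C suc k           ∎
  where open ≤-Reasoning

catalan>0 : ∀ ℓ → 0 < catalan ℓ
catalan>0 ℓ = m≥n⇒m/n>0 (central ℓ)
  where
    central : ∀ ℓ → suc ℓ ≤ (2 * ℓ) C ℓ
    central zero    = s≤s z≤n
    central (suc ℓ) = k<n⇒k<nCk (m<m+n (suc ℓ) (s≤s z≤n))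

catalanBinom : ℕ → ℕ → ℤ
catalanBinom k ℓ = + (catalan ℓ * binomK k ℓ)

catalanBinom-triangular : ∀ {k ℓ} → k < ℓ → catalanBinom k ℓ ≡ 0ℤ
catalanBinom-triangular {k} {ℓ} k<ℓ =
  trans (cong (λ b → + (catalan ℓ * b)) (k>n⇒nCk≡0 k+ℓ<2ℓ)) (cong +_ (ℕ.*-zeroʳ (catalan ℓ)))
  where
    k+ℓ<2ℓ : k + ℓ < 2 * ℓ
    k+ℓ<2ℓ = subst (k + ℓ <_) (cong (λ m → ℓ + m) (sym (ℕ.+-identityʳ ℓ))) (ℕ.+-monoˡ-< ℓ k<ℓ)

catalanBinom-diagonal≢0 : ∀ ℓ → catalanBinom ℓ ℓ ≢ 0ℤ
catalanBinom-diagonal≢0 ℓ eq = ℕ.<⇒≢ (catalan>0 ℓ) (sym catalan≡0)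
  where
    binomK-diagonal : binomK ℓ ℓ ≡ 1
    binomK-diagonal = trans (cong (λ m → (ℓ + m) C (2 * ℓ)) (sym (ℕ.+-identityʳ ℓ))) (nCn≡1 (2 * ℓ))
    catalan≡0 : catalan ℓ ≡ 0
    catalan≡0 = trans (sym (ℕ.*-identityʳ (catalan ℓ)))
                      (trans (cong (catalan ℓ *_) (sym binomK-diagonal)) (ℤ.+-injective eq))

catalanBinom-independent : (d : ℕ → ℤ) (n : ℕ) →
  (∀ k → ∑ (upTo n) (λ ℓ → d ℓ *ℤ catalanBinom k ℓ) ≡ 0ℤ) → ∀ ℓ → ℓ < n → d ℓ ≡ 0ℤ
catalanBinom-independent d n combination≡0 = <-rec (λ ℓ → ℓ < n → d ℓ ≡ 0ℤ) step
  where
    step : ∀ ℓ → (∀ {i} → i < ℓ → i < n → d i ≡ 0ℤ) → ℓ < n → d ℓ ≡ 0ℤ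
    step ℓ earlier≡0 ℓ<n =
      [ id , ⊥-elim ∘ catalanBinom-diagonal≢0 ℓ ]′ (ℤ.i*j≡0⇒i≡0∨j≡0 (d ℓ) leading-term≡0)
      where
        other-terms≡0 : ∀ i → i < n → i ≢ ℓ → d i *ℤ catalanBinom ℓ i ≡ 0ℤ
        other-terms≡0 i i<n i≢ℓ with <-cmp i ℓ
        ... | tri< i<ℓ _ _ = cong (_*ℤ catalanBinom ℓ i) (earlier≡0 i<ℓ i<n)
        ... | tri≈ _ i≡ℓ _ = ⊥-elim (i≢ℓ i≡ℓ)
        ... | tri> _ _ ℓ<i = trans (cong (d i *ℤ_) (catalanBinom-triangular ℓ<i)) (ℤ.*-zeroʳ (d i))
        open ≡-Reasoning
        leading-term≡0 : d ℓ *ℤ catalanBinom ℓ ℓ ≡ 0ℤ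
        leading-term≡0 = begin
          d ℓ *ℤ catalanBinom ℓ ℓ
            ≡⟨ sumℤ-applyUpTo-single (λ i → d i *ℤ catalanBinom ℓ i) ℓ<n other-terms≡0 ⟨
          sumℤ (applyUpTo (λ i → d i *ℤ catalanBinom ℓ i) n)
            ≡⟨ cong sumℤ (map-upTo (λ i → d i *ℤ catalanBinom ℓ i) n) ⟨
          ∑ (upTo n) (λ i → d i *ℤ catalanBinom ℓ i)
            ≡⟨ combination≡0 ℓ ⟩
          0ℤ ∎

catalanBinom-coefficients-unique : (a b : ℕ → ℤ) (n : ℕ) →
  (∀ ℓ → n < ℓ → a ℓ ≡ 0ℤ) → (∀ ℓ → n < ℓ → b ℓ ≡ 0ℤ) →
  (∀ k → ∑ (upTo (suc n)) (λ ℓ → a ℓ *ℤ catalanBinom k ℓ)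
       ≡ ∑ (upTo (suc n)) (λ ℓ → b ℓ *ℤ catalanBinom k ℓ)) →
  ∀ ℓ → a ℓ ≡ b ℓ
catalanBinom-coefficients-unique a b n a≡0 b≡0 same-expansion ℓ with n <? ℓ
... | yes n<ℓ = trans (a≡0 ℓ n<ℓ) (sym (b≡0 ℓ n<ℓ))
... | no  n≮ℓ = ℤ.i-j≡0⇒i≡j (a ℓ) (b ℓ)
  (catalanBinom-independent (λ ℓ → a ℓ -ℤ b ℓ) (suc n) difference≡0 ℓ (s≤s (≮⇒≥ n≮ℓ)))
  where
    open ≡-Reasoning
    distrib : ∀ x y w → (x -ℤ y) *ℤ w ≡ x *ℤ w -ℤ y *ℤ w
    distrib = solve-∀
    difference≡0 : ∀ k → ∑ (upTo (suc n)) (λ ℓ → (a ℓ -ℤ b ℓ) *ℤ catalanBinom k ℓ) ≡ 0ℤ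
    difference≡0 k = begin
      ∑ (upTo (suc n)) (λ ℓ → (a ℓ -ℤ b ℓ) *ℤ catalanBinom k ℓ)
        ≡⟨ ∑-cong (λ ℓ → distrib (a ℓ) (b ℓ) (catalanBinom k ℓ)) (upTo (suc n)) ⟩
      ∑ (upTo (suc n)) (λ ℓ → a ℓ *ℤ catalanBinom k ℓ -ℤ b ℓ *ℤ catalanBinom k ℓ)
        ≡⟨ ∑-distrib-− (upTo (suc n)) (λ ℓ → a ℓ *ℤ catalanBinom k ℓ) (λ ℓ → b ℓ *ℤ catalanBinom k ℓ) ⟩
      ∑ (upTo (suc n)) (λ ℓ → a ℓ *ℤ catalanBinom k ℓ) -ℤ ∑ (upTo (suc n)) (λ ℓ → b ℓ *ℤ catalanBinom k ℓ)
        ≡⟨ cong (_-ℤ ∑ (upTo (suc n)) (λ ℓ → b ℓ *ℤ catalanBinom k ℓ)) (same-expansion k) ⟩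
      ∑ (upTo (suc n)) (λ ℓ → b ℓ *ℤ catalanBinom k ℓ) -ℤ ∑ (upTo (suc n)) (λ ℓ → b ℓ *ℤ catalanBinom k ℓ)
        ≡⟨ ℤ.+-inverseʳ (∑ (upTo (suc n)) (λ ℓ → b ℓ *ℤ catalanBinom k ℓ)) ⟩
      0ℤ ∎

Atilde-PairSwap : ∀ {h m} {Ã : Vec ℕ m → ℕ → ℤ} → IsAtilde h m Ã →
  ∀ {u v} → PairSwap u v → ∀ ℓ → Ã u ℓ ≡ Ã v ℓ
Atilde-PairSwap {h} {m} {Ã} (expansion , support) {u} {v} s =
  catalanBinom-coefficients-unique (Ã u) (Ã v) (h * vsum u) (support u)
    (λ ℓ h*Σu<ℓ → support v ℓ (subst (λ σ → h * σ < ℓ) (PairSwap-vsum s) h*Σu<ℓ))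
    same-expansion
  where
    open ≡-Reasoning
    expansionAt : Vec ℕ m → ℕ → ℕ → ℤ
    expansionAt w σ k = ∑ (upTo (suc (h * σ))) (λ ℓ → Ã w ℓ *ℤ catalanBinom k ℓ)
    same-expansion : ∀ k → expansionAt u (vsum u) k ≡ expansionAt v (vsum u) k
    same-expansion k = begin
      expansionAt u (vsum u) k
        ≡⟨ expansion u k ⟨
      prodℤ (toList (vmap (λ i → + ((binomK k i ^ h) * catalan i)) u))
        ≡⟨ PairSwap-prodℤ (λ i → + ((binomK k i ^ h) * catalan i)) s ⟩
      prodℤ (toList (vmap (λ i → + ((binomK k i ^ h) * catalan i)) v))
        ≡⟨ expansion v k ⟩
      expansionAt v (vsum v) k
        ≡⟨ cong (λ σ → expansionAt v σ k) (PairSwap-vsum s) ⟨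
      expansionAt v (vsum u) k ∎

lemma3p7 : (n h M I ℓ : ℕ) → 1 ≤ n → 1 ≤ h → 1 ≤ M → (∃ λ t → I ≡ 1 + 2 * t) →
    (A : Vec ℕ (2 * M) → ℕ → ℤ) → IsAtilde h (2 * M) A →
    + 2 ∣ lemmaSum n h M I ℓ A
lemma3p7 n h M I ℓ _ _ _ (t , I≡1+2t) A A-is-Ã =
  ∣⇒∣ᵤ (subst (+ 2 Signed.∣_) (sym (∑-filter (λ v → vsum v ≟ I) (tuples (2 * M) n) term))
    (PairSwap-invariant-sum-even n (even-2* M) restricted restricted-invariant restricted-vanishes))
  where
    term : Vec ℕ (2 * M) → ℤ
    term v = A v ℓ *ℤ prodℤ (toList (vmap (λ i → + (catalan i ^ (h ∸ 1))) v))
    restricted : Vec ℕ (2 * M) → ℤ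
    restricted v = if does (vsum v ≟ I) then term v else 0ℤ
    restricted-invariant : ∀ {u v} → PairSwap u v → restricted u ≡ restricted v
    restricted-invariant s = cong₂ (λ σ x → if does (σ ≟ I) then x else 0ℤ) (PairSwap-vsum s)
      (cong₂ _*ℤ_ (Atilde-PairSwap {h} A-is-Ã s ℓ) (PairSwap-prodℤ (λ i → + (catalan i ^ (h ∸ 1))) s))
    I-odd : ¬ Even I
    I-odd = subst (¬_ ∘ Even) (sym I≡1+2t) (even⇒¬even-suc (even-2* t))
    restricted-vanishes : ∀ v → Even (vsum v) → restricted v ≡ 0ℤ
    restricted-vanishes v even
      rewrite dec-false (vsum v ≟ I) (λ Σv≡I → I-odd (subst Even Σv≡I even)) = refl
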